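{- For every integer $n\geq 0$, the number $C_n^{(3)}$ equals the coefficient of $t^n$ in the power series expansion of \[ \frac{1+t^2+t^3+t^5}{(1-t)(1-t^3)(1-t^4)(1-t^6)} \] (this is the integer sequence A028289 of the OEIS, which begins $1,1,2,4,5,7,11,13,17,23,\dots$).
   Context: Let $\Lambda_3=\mathbb{Z}_{\geq 0}^3$ with standard basis vectors $\mathbf{e}(1),\mathbf{e}(2),\mathbf{e}(3)$. Let $X_3=\{(1,-2,0),(-2,1,0),(-1,-1,1),(0,0,-1)\}$ (equivalently, the set of vectors $\mathbf{e}(k)-\mathbf{e}(i)-\mathbf{e}(j)$ with $i,j,k\in\{1,2,3\}$ and $3\mid k-i-j$). For $\mathbf{v},\mathbf{w}\in\Lambda_3$ write $\mathbf{v}\lessdot\mathbf{w}$ if $\mathbf{v}=\mathbf{w}+\mathbf{x}$ for some $\mathbf{x}\in X_3$, and let $\prec$ be the transitive closure of $\lessdot$ on $\Lambda_3$ (so $\mathbf{v}\prec\mathbf{w}$ iff there is a chain $\mathbf{v}=\mathbf{u}_0\lessdot\mathbf{u}_1\lessdot\dots\lessdot\mathbf{u}_m=\mathbf{w}$ with $m\geq1$ and all $\mathbf{u}_j\in\Lambda_3$). For $\mathbf{v}\in\Lambda_3$ let $I(\mathbf{v})=\{\mathbf{v}\}\cup\{\mathbf{w}\in\Lambda_3:\mathbf{w}\prec\mathbf{v}\}$. Define $C_n^{(3)}=|I(n\mathbf{e}(1))|$. -}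

module Defs where

open import Data.Nat using (ℕ; zero; suc; _+_; _*_; _∸_; _≟_)
open import Data.Nat.DivMod using (_%_)
open import Data.Product using (_×_; _,_; ∃-syntax)
open import Data.Sum using (_⊎_)
open import Data.List using (List; length)
open import Data.List.Membership.Propositional using (_∈_)
open import Data.List.Relation.Unary.Unique.Propositional using (Unique)
open import Relation.Nullary using (yes; no)
open import Relation.Binary.PropositionalEquality using (_≡_)
open import Relation.Binary.Construct.Closure.Transitive using (TransClosure)
open import Function.Bundles using (_⇔_)

Λ₃ : Set
Λ₃ = ℕ × ℕ × ℕ

e1 : ℕ → Λ₃
e1 n = (n , 0 , 0)

-- v ⋖ w  iff  v = w + x with x ∈ X₃ = {(1,-2,0),(-2,1,0),(-1,-1,1),(0,0,-1)},
-- both v and w in Λ₃.  One constructor per element of X₃.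
data _⋖_ : Λ₃ → Λ₃ → Set where
  x₁ : ∀ {a b c} → (suc a , b , c) ⋖ (a , suc (suc b) , c)
  x₂ : ∀ {a b c} → (a , suc b , c) ⋖ (suc (suc a) , b , c)
  x₃ : ∀ {a b c} → (a , b , suc c) ⋖ (suc a , suc b , c)
  x₄ : ∀ {a b c} → (a , b , c) ⋖ (a , b , suc c)

_≺_ : Λ₃ → Λ₃ → Set
_≺_ = TransClosure _⋖_

InI : Λ₃ → Λ₃ → Set
InI v w = (w ≡ v) ⊎ (w ≺ v)

HasCard : (Λ₃ → Set) → ℕ → Set
HasCard P k = ∃[ xs ] (Unique xs × (∀ w → (w ∈ xs) ⇔ P w) × (length xs ≡ k))

Series : Set
Series = ℕ → ℕ

sumTo : ℕ → (ℕ → ℕ) → ℕ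
sumTo zero f = f 0
sumTo (suc n) f = sumTo n f + f (suc n)

_⊛_ : Series → Series → Series
(f ⊛ g) n = sumTo n (λ i → f i * g (n ∸ i))

-- expansion of 1/(1 - t^(suc k)) = Σ_m t^((suc k) m)
geom : ℕ → Series
geom k m with m % suc k ≟ 0
... | yes _ = 1
... | no _  = 0

numer : Series
numer 0 = 1
numer 2 = 1
numer 3 = 1
numer 5 = 1
numer _ = 0

genFun : Series
genFun = numer ⊛ (geom 0 ⊛ (geom 2 ⊛ (geom 3 ⊛ geom 5)))

-- Each step v ⋖ w lowers the weight a + 2b + 3c by 0 or 3, and conversely every (a , b , c)
-- whose weight is at most n and congruent to n mod 3 lies below (n , 0 , 0); so I(n e₁) consists
-- of the points with a + 2b + 3c + 3k = n for some k. Splitting b = p + 2d and k = q + 2f with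
-- p, q ∈ {0, 1} matches these bijectively with the solutions of (2p + 3q) + a + 3c + 4d + 6f = n,
-- which the factors of numer ⊛ (geom 0 ⊛ (geom 2 ⊛ (geom 3 ⊛ geom 5))) count one variable at a time.
module Submission where

open import Defs
open import Data.Bool using (Bool; true; false)
open import Data.Nat using (ℕ; zero; suc; _+_; _*_; _∸_; _≤_; _≟_; z≤n)
open import Data.Nat.Properties
open import Data.Nat.DivMod using (_%_; _/_; m*n%n≡0; m*n/n≡m; m/n*n≡m)
open import Data.Nat.Divisibility using (m%n≡0⇒n∣m)
open import Data.Nat.Solver using (module +-*-Solver)
open import Data.Product using (_×_; _,_; proj₁; proj₂; ∃-syntax)
open import Data.Sum using (inj₁; inj₂)
open import Data.Empty using (⊥-elim)
open import Data.List using (List; []; _∷_; [_]; _++_; map; length; cartesianProduct)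
open import Data.List.Properties using (length-++; length-map)
open import Data.List.Membership.Propositional using (_∈_)
open import Data.List.Membership.Propositional.Properties
  using (∈-++⁻; ∈-++⁺ˡ; ∈-++⁺ʳ; ∈-map⁻; ∈-map⁺; ∈-cartesianProduct⁻; ∈-cartesianProduct⁺)
open import Data.List.Relation.Unary.Any using (here; there)
import Data.List.Relation.Unary.All as All
import Data.List.Relation.Unary.All.Properties as All
open import Data.List.Relation.Unary.AllPairs using ([]; _∷_)
open import Data.List.Relation.Unary.Unique.Propositional using (Unique)
import Data.List.Relation.Unary.Unique.Propositional.Properties as Unique
open import Relation.Nullary using (¬_; yes; no)
open import Relation.Binary.PropositionalEquality
  using (_≡_; refl; sym; trans; cong; cong₂; subst; module ≡-Reasoning)
open import Relation.Binary.Construct.Closure.Transitive using (_∷_) renaming ([_] to [_]⁺)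
open import Relation.Binary.Construct.Closure.ReflexiveTransitive using (Star; ε; _◅_; _◅◅_)
open import Function.Base using (_∘_)
open import Function.Bundles using (_⇔_; mk⇔)
open import Function.Construct.Composition using (_⇔-∘_)
open import Function.Construct.Symmetry using (⇔-sym)

open +-*-Solver using (solve; _:+_; _:*_; _:=_; con)

private
  variable
    A B : Set

sumTo-cong : ∀ n {f g : ℕ → ℕ} → (∀ i → f i ≡ g i) → sumTo n f ≡ sumTo n g
sumTo-cong zero    f≗g = f≗g 0
sumTo-cong (suc n) f≗g = cong₂ _+_ (sumTo-cong n f≗g) (f≗g (suc n))

concatUpTo : ℕ → (ℕ → List A) → List A
concatUpTo zero    f = f 0
concatUpTo (suc n) f = concatUpTo n f ++ f (suc n)

length-concatUpTo : ∀ n (f : ℕ → List A) →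
                    length (concatUpTo n f) ≡ sumTo n (λ i → length (f i))
length-concatUpTo zero    f = refl
length-concatUpTo (suc n) f =
  trans (length-++ (concatUpTo n f)) (cong (_+ length (f (suc n))) (length-concatUpTo n f))

∈-concatUpTo⁺ : ∀ {n i x} (f : ℕ → List A) → i ≤ n → x ∈ f i → x ∈ concatUpTo n f
∈-concatUpTo⁺ {n = zero}  f z≤n x∈ = x∈
∈-concatUpTo⁺ {n = suc n} f i≤n x∈ with m≤n⇒m<n∨m≡n i≤n
... | inj₁ i<1+n = ∈-++⁺ˡ (∈-concatUpTo⁺ f (≤-pred i<1+n) x∈)
... | inj₂ refl  = ∈-++⁺ʳ (concatUpTo n f) x∈

∈-concatUpTo⁻ : ∀ n (f : ℕ → List A) {x} → x ∈ concatUpTo n f → ∃[ i ] i ≤ n × x ∈ f i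
∈-concatUpTo⁻ zero    f x∈ = 0 , ≤-refl , x∈
∈-concatUpTo⁻ (suc n) f x∈ with ∈-++⁻ (concatUpTo n f) x∈
... | inj₁ x∈ˡ = let i , i≤n , x∈fi = ∈-concatUpTo⁻ n f x∈ˡ in i , m≤n⇒m≤1+n i≤n , x∈fi
... | inj₂ x∈ʳ = suc n , ≤-refl , x∈ʳ

concatUpTo-unique : ∀ {f : ℕ → List A} (index : A → ℕ) →
                    (∀ {i x} → x ∈ f i → index x ≡ i) → (∀ i → Unique (f i)) →
                    ∀ n → Unique (concatUpTo n f)
concatUpTo-unique index index-∈ unique zero    = unique 0
concatUpTo-unique {f = f} index index-∈ unique (suc n) =
  Unique.++⁺ (concatUpTo-unique index index-∈ unique n) (unique (suc n)) disjoint
  where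
  disjoint : ∀ {x} → ¬ (x ∈ concatUpTo n f × x ∈ f (suc n))
  disjoint (x∈ˡ , x∈ʳ) with ∈-concatUpTo⁻ n f x∈ˡ
  ... | i , i≤n , x∈fi = 1+n≰n (subst (_≤ n) (trans (sym (index-∈ x∈fi)) (index-∈ x∈ʳ)) i≤n)

length-cartesianProduct : ∀ (xs : List A) (ys : List B) →
                          length (cartesianProduct xs ys) ≡ length xs * length ys
length-cartesianProduct []       ys = refl
length-cartesianProduct (x ∷ xs) ys =
  trans (length-++ (map (x ,_) ys))
        (cong₂ _+_ (length-map (x ,_) ys) (length-cartesianProduct xs ys))

map⁺-injectiveOn : ∀ (f : A → B) {xs} → (∀ {x y} → x ∈ xs → y ∈ xs → f x ≡ f y → x ≡ y) →
                   Unique xs → Unique (map f xs)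
map⁺-injectiveOn f {[]}     _   []           = []
map⁺-injectiveOn f {x ∷ xs} inj (x∉xs ∷ uxs) =
  All.map⁺ (All.tabulate λ y∈ fx≡fy → All.lookup x∉xs y∈ (inj (here refl) (there y∈) fx≡fy))
  ∷ map⁺-injectiveOn f (λ x∈ y∈ → inj (there x∈) (there y∈)) uxs

record Enumeration (weight : A → ℕ) (count : Series) : Set where
  field
    list        : ℕ → List A
    unique      : ∀ n → Unique (list n)
    sound       : ∀ {n x} → x ∈ list n → weight x ≡ n
    complete    : ∀ x → x ∈ list (weight x)
    length-list : ∀ n → length (list n) ≡ count n

_⊗_ : ∀ {wA : A → ℕ} {wB : B → ℕ} {f g : Series} → Enumeration wA f → Enumeration wB g →
      Enumeration (λ xy → wA (proj₁ xy) + wB (proj₂ xy)) (f ⊛ g)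
_⊗_ {A = A} {B} {wA} {wB} {f} {g} E F = record
  { list        = list
  ; unique      = unique
  ; sound       = sound
  ; complete    = complete
  ; length-list = length-list
  }
  where
  module E = Enumeration E
  module F = Enumeration F

  block : ℕ → ℕ → List (A × B)
  block n i = cartesianProduct (E.list i) (F.list (n ∸ i))

  list : ℕ → List (A × B)
  list n = concatUpTo n (block n)

  unique : ∀ n → Unique (list n)
  unique n = concatUpTo-unique (wA ∘ proj₁)
    (λ {i} xy∈ → E.sound (proj₁ (∈-cartesianProduct⁻ (E.list i) (F.list (n ∸ i)) xy∈)))
    (λ i → Unique.cartesianProduct⁺ (E.unique i) (F.unique (n ∸ i))) n

  sound : ∀ {n xy} → xy ∈ list n → wA (proj₁ xy) + wB (proj₂ xy) ≡ n
  sound {n} {x , y} xy∈ with ∈-concatUpTo⁻ n (block n) xy∈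
  ... | i , i≤n , xy∈ᵢ with ∈-cartesianProduct⁻ (E.list i) (F.list (n ∸ i)) xy∈ᵢ
  ...   | x∈ , y∈ = trans (cong₂ _+_ (E.sound x∈) (F.sound y∈)) (m+[n∸m]≡n i≤n)

  complete : ∀ xy → xy ∈ list (wA (proj₁ xy) + wB (proj₂ xy))
  complete (x , y) = ∈-concatUpTo⁺ (block _) (m≤m+n (wA x) (wB y))
    (∈-cartesianProduct⁺ (E.complete x)
      (subst (λ m → y ∈ F.list m) (sym (m+n∸m≡n (wA x) (wB y))) (F.complete y)))

  length-list : ∀ n → length (list n) ≡ (f ⊛ g) n
  length-list n = trans (length-concatUpTo n (block n)) (sumTo-cong n λ i →
    trans (length-cartesianProduct (E.list i) (F.list (n ∸ i)))
          (cong₂ _*_ (E.length-list i) (F.length-list (n ∸ i))))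

multiples : ℕ → ℕ → List ℕ
multiples k i with i % suc k ≟ 0
... | yes _ = [ i / suc k ]
... | no  _ = []

geometric : ∀ k → Enumeration (_* suc k) (geom k)
geometric k = record
  { list        = multiples k
  ; unique      = unique
  ; sound       = sound
  ; complete    = complete
  ; length-list = length-multiples
  }
  where
  unique : ∀ i → Unique (multiples k i)
  unique i with i % suc k ≟ 0
  ... | yes _ = All.[] ∷ []
  ... | no  _ = []

  sound : ∀ {i x} → x ∈ multiples k i → x * suc k ≡ i
  sound {i} x∈ with i % suc k ≟ 0 | x∈
  ... | yes i%[1+k]≡0 | here refl = m/n*n≡m (m%n≡0⇒n∣m i (suc k) i%[1+k]≡0)

  complete : ∀ x → x ∈ multiples k (x * suc k)
  complete x with x * suc k % suc k ≟ 0
  ... | yes _                = here (sym (m*n/n≡m x (suc k)))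
  ... | no  x*[1+k]%[1+k]≢0 = ⊥-elim (x*[1+k]%[1+k]≢0 (m*n%n≡0 x (suc k)))

  length-multiples : ∀ i → length (multiples k i) ≡ geom k i
  length-multiples i with i % suc k ≟ 0
  ... | yes _ = refl
  ... | no  _ = refl

bit : Bool → ℕ
bit false = 0
bit true  = 1

numerWeight : Bool × Bool → ℕ
numerWeight (p , q) = bit p * 2 + bit q * 3

-- numer = (1 + t²)(1 + t³), and (p , q) indexes its term t^(2 bit p + 3 bit q).
numerTerms : ℕ → List (Bool × Bool)
numerTerms 0 = [ false , false ]
numerTerms 2 = [ true  , false ]
numerTerms 3 = [ false , true  ]
numerTerms 5 = [ true  , true  ]
numerTerms _ = []

numerator : Enumeration numerWeight numer
numerator = record
  { list        = numerTerms
  ; unique      = unique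
  ; sound       = sound
  ; complete    = complete
  ; length-list = length-numerTerms
  }
  where
  unique : ∀ i → Unique (numerTerms i)
  unique 0 = All.[] ∷ []
  unique 1 = []
  unique 2 = All.[] ∷ []
  unique 3 = All.[] ∷ []
  unique 4 = []
  unique 5 = All.[] ∷ []
  unique (suc (suc (suc (suc (suc (suc _)))))) = []

  sound : ∀ {i pq} → pq ∈ numerTerms i → numerWeight pq ≡ i
  sound {0} (here refl) = refl
  sound {2} (here refl) = refl
  sound {3} (here refl) = refl
  sound {5} (here refl) = refl

  complete : ∀ pq → pq ∈ numerTerms (numerWeight pq)
  complete (false , false) = here refl
  complete (true  , false) = here refl
  complete (false , true ) = here refl
  complete (true  , true ) = here refl

  length-numerTerms : ∀ i → length (numerTerms i) ≡ numer i
  length-numerTerms 0 = refl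
  length-numerTerms 1 = refl
  length-numerTerms 2 = refl
  length-numerTerms 3 = refl
  length-numerTerms 4 = refl
  length-numerTerms 5 = refl
  length-numerTerms (suc (suc (suc (suc (suc (suc _)))))) = refl

Solution : Set
Solution = (Bool × Bool) × ℕ × ℕ × ℕ × ℕ

solutionWeight : Solution → ℕ
solutionWeight (pq , a , c , d , f) = numerWeight pq + (a * 1 + (c * 3 + (d * 4 + f * 6)))

solutions : Enumeration solutionWeight genFun
solutions = numerator ⊗ (geometric 0 ⊗ (geometric 2 ⊗ (geometric 3 ⊗ geometric 5)))

weight : Λ₃ → ℕ
weight (a , b , c) = a + b * 2 + c * 3

_≤₃_ : ℕ → ℕ → Set
m ≤₃ n = ∃[ k ] m + k * 3 ≡ n

≤₃-refl : ∀ n → n ≤₃ n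
≤₃-refl n = 0 , +-identityʳ n

≤₃-trans : ∀ {l m n} → l ≤₃ m → m ≤₃ n → l ≤₃ n
≤₃-trans {l} {m} {n} (j , l+3j≡m) (k , m+3k≡n) = j + k , (begin
  l + (j + k) * 3    ≡⟨ solve 3 (λ l j k → l :+ (j :+ k) :* con 3 := l :+ j :* con 3 :+ k :* con 3) refl l j k ⟩
  l + j * 3 + k * 3  ≡⟨ cong (_+ k * 3) l+3j≡m ⟩
  m + k * 3          ≡⟨ m+3k≡n ⟩
  n                  ∎)
  where open ≡-Reasoning

⋖-weight : ∀ {v w} → v ⋖ w → weight v ≤₃ weight w
⋖-weight (x₁ {a} {b} {c}) = 1 , solve 3 (λ a b c →
  con 1 :+ a :+ b :* con 2 :+ c :* con 3 :+ con 1 :* con 3 := a :+ (con 2 :+ b) :* con 2 :+ c :* con 3) refl a b c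
⋖-weight (x₂ {a} {b} {c}) = 0 , solve 3 (λ a b c →
  a :+ (con 1 :+ b) :* con 2 :+ c :* con 3 :+ con 0 :* con 3 := con 2 :+ a :+ b :* con 2 :+ c :* con 3) refl a b c
⋖-weight (x₃ {a} {b} {c}) = 0 , solve 3 (λ a b c →
  a :+ b :* con 2 :+ (con 1 :+ c) :* con 3 :+ con 0 :* con 3 := con 1 :+ a :+ (con 1 :+ b) :* con 2 :+ c :* con 3) refl a b c
⋖-weight (x₄ {a} {b} {c}) = 1 , solve 3 (λ a b c →
  a :+ b :* con 2 :+ c :* con 3 :+ con 1 :* con 3 := a :+ b :* con 2 :+ (con 1 :+ c) :* con 3) refl a b c

≺-weight : ∀ {v w} → v ≺ w → weight v ≤₃ weight w
≺-weight [ v⋖w ]⁺      = ⋖-weight v⋖w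
≺-weight (v⋖u ∷ u≺w)  = ≤₃-trans (⋖-weight v⋖u) (≺-weight u≺w)

_⋖*_ : Λ₃ → Λ₃ → Set
_⋖*_ = Star _⋖_

⋖*⇒InI : ∀ {v w} → v ⋖* w → InI w v
⋖*⇒InI ε = inj₁ refl
⋖*⇒InI (v⋖u ◅ u⋖*w) with ⋖*⇒InI u⋖*w
... | inj₁ refl = inj₂ [ v⋖u ]⁺
... | inj₂ u≺w  = inj₂ (v⋖u ∷ u≺w)

*-suc-shift : ∀ m k a → m * k + (k + a) ≡ suc m * k + a
*-suc-shift m k a = trans (sym (+-assoc (m * k) k a)) (cong (_+ a) (+-comm (m * k) k))

b-to-a : ∀ b a c → (a , b , c) ⋖* (b * 2 + a , 0 , c)
b-to-a zero    a c = ε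
b-to-a (suc b) a c = x₂ ◅ subst (λ a′ → (2 + a , b , c) ⋖* (a′ , 0 , c))
                             (*-suc-shift b 2 a) (b-to-a b (2 + a) c)

c-up : ∀ k a c → (a , 0 , c) ⋖* (a , 0 , k + c)
c-up zero    a c = ε
c-up (suc k) a c = c-up k a c ◅◅ (x₄ ◅ ε)

c-to-a : ∀ c a → (a , 0 , c) ⋖* (c * 3 + a , 0 , 0)
c-to-a zero    a = ε
c-to-a (suc c) a = x₃ ◅ x₂ ◅ subst (λ a′ → (3 + a , 0 , c) ⋖* (a′ , 0 , 0))
                                   (*-suc-shift c 3 a) (c-to-a c (3 + a))

weight-e1 : ∀ n → weight (e1 n) ≡ n
weight-e1 n = trans (+-identityʳ (n + 0)) (+-identityʳ n)

InI-e1⇔ : ∀ n w → InI (e1 n) w ⇔ weight w ≤₃ n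
InI-e1⇔ n w@(a , b , c) = mk⇔ to from
  where
  to : InI (e1 n) w → weight w ≤₃ n
  to (inj₁ refl) = subst (weight w ≤₃_) (weight-e1 n) (≤₃-refl (weight w))
  to (inj₂ w≺)   = subst (weight w ≤₃_) (weight-e1 n) (≺-weight w≺)

  from : weight w ≤₃ n → InI (e1 n) w
  from (k , w+3k≡n) = ⋖*⇒InI (subst (λ m → w ⋖* (m , 0 , 0)) total
    (b-to-a b a c ◅◅ c-up k (b * 2 + a) c ◅◅ c-to-a (k + c) (b * 2 + a)))
    where
    total : (k + c) * 3 + (b * 2 + a) ≡ n
    total = trans (solve 4 (λ a b c k → (k :+ c) :* con 3 :+ (b :* con 2 :+ a)
                                        := a :+ b :* con 2 :+ c :* con 3 :+ k :* con 3) refl a b c k)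
                  w+3k≡n

bit+*2-split : ∀ n → ∃[ p ] ∃[ d ] bit p + d * 2 ≡ n
bit+*2-split zero = false , 0 , refl
bit+*2-split (suc n) with bit+*2-split n
... | false , d , refl = true , d , refl
... | true  , d , refl = false , suc d , refl

bit+*2-injective : ∀ p q d e → bit p + d * 2 ≡ bit q + e * 2 → p ≡ q × d ≡ e
bit+*2-injective false false d e eq = refl , *-cancelʳ-≡ d e 2 eq
bit+*2-injective true  true  d e eq = refl , *-cancelʳ-≡ d e 2 (suc-injective eq)
bit+*2-injective false true  d e eq = ⊥-elim (even≢odd d e (trans (*-comm 2 d) (trans eq (cong suc (*-comm e 2)))))
bit+*2-injective true  false d e eq = ⊥-elim (even≢odd e d (trans (*-comm 2 e) (trans (sym eq) (cong suc (*-comm d 2)))))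

-- ((p , q) , a , c , d , f) encodes the point (a , b , c) and the slack k of a + 2b + 3c + 3k = n,
-- split by parity as b = bit p + 2d and k = bit q + 2f.
decode : Solution → Λ₃
decode ((p , q) , a , c , d , f) = a , bit p + d * 2 , c

slack : Solution → ℕ
slack ((p , q) , a , c , d , f) = bit q + f * 2

solutionWeight-decode : ∀ s → solutionWeight s ≡ weight (decode s) + slack s * 3
solutionWeight-decode ((p , q) , a , c , d , f) = solve 6 (λ p q a c d f →
    p :* con 2 :+ q :* con 3 :+ (a :* con 1 :+ (c :* con 3 :+ (d :* con 4 :+ f :* con 6)))
    := a :+ (p :+ d :* con 2) :* con 2 :+ c :* con 3 :+ (q :+ f :* con 2) :* con 3)
  refl (bit p) (bit q) a c d f

decode-injective : ∀ {s t} → solutionWeight s ≡ solutionWeight t → decode s ≡ decode t → s ≡ t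
decode-injective {s@((p , q) , a , c , d , f)} {t@((p′ , q′) , a′ , c′ , d′ , f′)} sw≡ dec≡
  with cong proj₁ dec≡ | cong (proj₂ ∘ proj₂) dec≡ | bit+*2-injective p p′ d d′ (cong (proj₁ ∘ proj₂) dec≡)
... | refl | refl | refl , refl with bit+*2-injective q q′ f f′ slack≡
  where
  slack≡ : slack s ≡ slack t
  slack≡ = *-cancelʳ-≡ (slack s) (slack t) 3 (+-cancelˡ-≡ (weight (decode s)) _ _
             (trans (sym (solutionWeight-decode s)) (trans sw≡ (solutionWeight-decode t))))
... | refl , refl = refl

private module S = Enumeration solutions

∈-decode⇔ : ∀ n w → w ∈ map decode (S.list n) ⇔ weight w ≤₃ n
∈-decode⇔ n w@(a , b , c) = mk⇔ to from
  where
  to : w ∈ map decode (S.list n) → weight w ≤₃ n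
  to w∈ with ∈-map⁻ decode w∈
  ... | s , s∈ , refl = slack s , trans (sym (solutionWeight-decode s)) (S.sound s∈)

  from : weight w ≤₃ n → w ∈ map decode (S.list n)
  from (k , w+3k≡n) with bit+*2-split b | bit+*2-split k
  ... | p , d , refl | q , f , refl = ∈-map⁺ decode
    (subst (λ m → s ∈ S.list m) (trans (solutionWeight-decode s) w+3k≡n) (S.complete s))
    where
    s : Solution
    s = (p , q) , a , c , d , f

theorem3p9 : ∀ (n : ℕ) → HasCard (InI (e1 n)) (genFun n)
theorem3p9 n =
    map decode (S.list n)
  , map⁺-injectiveOn decode (λ s∈ t∈ → decode-injective (trans (S.sound {n} s∈) (sym (S.sound {n} t∈))))
                            (S.unique n)
  , (λ w → ⇔-sym (InI-e1⇔ n w) ⇔-∘ ∈-decode⇔ n w)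
  , trans (length-map decode (S.list n)) (S.length-list n)
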